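{- Let $R$ be a tolerance on $U$ induced by an irredundant covering of $U$. Then for every $(A,B)\in\mathit{RS}$, the pseudocomplement and dual pseudocomplement of $(A,B)$ in the lattice $(\mathit{RS},\le)$ are $(A,B)^*=(B^{c\downarrow},B^{c\uparrow})$ and $(A,B)^+=(A^{c\downarrow},A^{c\uparrow})$.
   Context: A tolerance on $U$ is a reflexive symmetric relation; $R(x)=\{y\mid x\,R\,y\}$; $X^{\downarrow}=\{x\mid R(x)\subseteq X\}$, $X^{\uparrow}=\{x\mid R(x)\cap X\neq\emptyset\}$, $X^c=U\setminus X$, and $X^{c\downarrow}=(X^c)^{\downarrow}$ etc. A covering of $U$ is a family of nonempty subsets with union $U$, irredundant if no member can be removed keeping a covering; its induced tolerance is $\bigcup\{X\times X\mid X\in\mathcal{H}\}$. $\mathit{RS}=\{(X^{\downarrow},X^{\uparrow})\mid X\subseteq U\}$ ordered coordinatewise; for such $R$ it is a complete lattice with bottom $(\emptyset,\emptyset)$ and top $(U,U)$, with $\bigwedge(A_i,B_i)=(\bigcap A_i,(\bigcap B_i)^{\downarrow\uparrow})$ and $\bigvee(A_i,B_i)=((\bigcup A_i)^{\uparrow\downarrow},\bigcup B_i)$. The pseudocomplement $a^*$ satisfies $a\wedge z=\text{bottom}\iff z\le a^*$; the dual pseudocomplement $a^+$ satisfies $a\vee z=\text{top}\iff z\ge a^+$. -}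

module Defs where

open import Level using (0ℓ)
open import Data.Product using (Σ; ∃; _×_; _,_)
open import Data.Empty using (⊥)
open import Data.Unit using (⊤)
open import Relation.Nullary using (¬_)
open import Relation.Binary.PropositionalEquality using (_≢_)
open import Relation.Unary using (Pred; _⊆_; _∩_; _∪_; ∅; U; _≐_)

IsCovering : {X I : Set} → (I → Pred X 0ℓ) → Set
IsCovering {X} {I} H = (∀ i → ∃ λ x → H i x) × (∀ (x : X) → ∃ λ i → H i x)

-- Irredundant: no member can be removed keeping a covering
-- (the members other than H i never cover X).
IsIrredundantCovering : {X I : Set} → (I → Pred X 0ℓ) → Set
IsIrredundantCovering {X} {I} H =
  IsCovering H × (∀ (i : I) → ¬ (∀ (x : X) → ∃ λ j → j ≢ i × H j x))

induced : {X I : Set} → (I → Pred X 0ℓ) → X → X → Set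
induced H x y = ∃ λ i → H i x × H i y

module Approx {X : Set} (R : X → X → Set) where

  _↓ : Pred X 0ℓ → Pred X 0ℓ
  (Y ↓) x = ∀ y → R x y → Y y

  _↑ : Pred X 0ℓ → Pred X 0ℓ
  (Y ↑) x = ∃ λ y → R x y × Y y

  _ᶜ : Pred X 0ℓ → Pred X 0ℓ
  (Y ᶜ) x = ¬ Y x

  Pair : Set₁
  Pair = Pred X 0ℓ × Pred X 0ℓ

  InRS : Pair → Set₁
  InRS (A , B) = Σ (Pred X 0ℓ) λ Y → (A ≐ (Y ↓)) × (B ≐ (Y ↑))

  _≤ᴿ_ : Pair → Pair → Set
  (A , B) ≤ᴿ (C , D) = (A ⊆ C) × (B ⊆ D)

  _≈ᴿ_ : Pair → Pair → Set
  (A , B) ≈ᴿ (C , D) = (A ≐ C) × (B ≐ D)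

  bot top : Pair
  bot = (∅ , ∅)
  top = (U , U)

  -- lattice operations of RS (binary case of the given formulas)
  _∧ᴿ_ : Pair → Pair → Pair
  (A , B) ∧ᴿ (C , D) = (A ∩ C , (((B ∩ D) ↓) ↑))

  _∨ᴿ_ : Pair → Pair → Pair
  (A , B) ∨ᴿ (C , D) = ((((A ∪ C) ↑) ↓) , B ∪ D)

  IsPseudocomplement : Pair → Pair → Set₁
  IsPseudocomplement a c =
    InRS c × (∀ z → InRS z → ((a ∧ᴿ z) ≈ᴿ bot → z ≤ᴿ c) × (z ≤ᴿ c → (a ∧ᴿ z) ≈ᴿ bot))

  IsDualPseudocomplement : Pair → Pair → Set₁
  IsDualPseudocomplement a c =
    InRS c × (∀ z → InRS z → ((a ∨ᴿ z) ≈ᴿ top → c ≤ᴿ z) × (c ≤ᴿ z → (a ∨ᴿ z) ≈ᴿ top))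

-- Every block H i of an irredundant covering has a private point p_i, lying in no
-- other block, and then R(p_i) = H i.  Hence a lower approximation S↓ is empty
-- exactly when S contains no block, and an upper approximation S↑ is everything
-- exactly when S meets every block.  For (A , B) = (Y↓ , Y↑) and z = (Z↓ , Z↑) this
-- turns  (A , B) ∧ z = ⊥  into  Z ∩ B = ∅  and  (A , B) ∨ z = ⊤  into  Aᶜ ⊆ Z, from
-- which both formulas follow by monotonicity of ↓ and ↑.
module Submission where

open import Defs
open import Level using (0ℓ)
open import Data.Product using (_×_; _,_; ∃; proj₁; proj₂; map; map₂)
open import Data.Sum using (inj₁; inj₂)
import Data.Sum as Sum
open import Data.Unit using (tt)
open import Data.Empty using (⊥-elim)
open import Function using (_∘_)
open import Relation.Nullary using (¬_; yes; no)
open import Relation.Binary.Definitions using (Reflexive)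
open import Relation.Binary.PropositionalEquality using (_≡_; subst)
open import Relation.Unary using (Pred; _⊆_; _∩_; _∪_; ∅; U)
open import Relation.Unary.Properties using (≐-refl)
open import Axiom.ExcludedMiddle using (ExcludedMiddle)
open import Axiom.DoubleNegationElimination using (em⇒dne)

module ApproximationProperties {X : Set} (R : X → X → Set) where
  open Approx R

  ↓-mono : {P Q : Pred X 0ℓ} → P ⊆ Q → P ↓ ⊆ Q ↓
  ↓-mono P⊆Q P↓x y xRy = P⊆Q (P↓x y xRy)

  ↑-mono : {P Q : Pred X 0ℓ} → P ⊆ Q → P ↑ ⊆ Q ↑
  ↑-mono P⊆Q (y , xRy , Py) = y , xRy , P⊆Q Py

  ↑-empty : {P : Pred X 0ℓ} → P ⊆ ∅ → P ↑ ⊆ ∅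
  ↑-empty P⊆∅ (_ , _ , Py) = P⊆∅ Py

  ↓-full : {P : Pred X 0ℓ} → U ⊆ P → U ⊆ P ↓
  ↓-full U⊆P _ y _ = U⊆P {y} tt

  module _ (refl : Reflexive R) where

    ↓⊆id : {P : Pred X 0ℓ} → P ↓ ⊆ P
    ↓⊆id {x = x} P↓x = P↓x x refl

    id⊆↑ : {P : Pred X 0ℓ} → P ⊆ P ↑
    id⊆↑ {x = x} Px = x , refl , Px

    InRS⇒lower⊆upper : {A B : Pred X 0ℓ} → InRS (A , B) → A ⊆ B
    InRS⇒lower⊆upper (_ , (A⊆Y↓ , _) , (_ , Y↑⊆B)) = Y↑⊆B ∘ id⊆↑ ∘ ↓⊆id ∘ A⊆Y↓

module _ {X I : Set} (H : I → Pred X 0ℓ) where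
  open Approx (induced H)
  open ApproximationProperties (induced H)

  induced-refl : (∀ x → ∃ λ i → H i x) → Reflexive (induced H)
  induced-refl cover {x} = let (i , Hix) = cover x in i , Hix , Hix

  block⊆induced : ∀ {i x} → H i x → H i ⊆ induced H x
  block⊆induced Hix Hiy = _ , Hix , Hiy

  meets⇒block⊆↑ : ∀ {i y} {P : Pred X 0ℓ} → H i y → P y → H i ⊆ P ↑
  meets⇒block⊆↑ Hiy Py Hix = _ , block⊆induced Hix Hiy , Py

  IsPrivatePoint : I → X → Set
  IsPrivatePoint i p = H i p × (∀ j → H j p → j ≡ i)

  privatePoint⇒induced⊆block : ∀ {i p} → IsPrivatePoint i p → induced H p ⊆ H i
  privatePoint⇒induced⊆block (_ , only-i) {y} (j , Hjp , Hjy) =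
    subst (λ k → H k y) (only-i j Hjp) Hjy

  -- A block all of whose points lie in other blocks could be removed from the covering.
  irredundant⇒privatePoint : ExcludedMiddle 0ℓ → IsIrredundantCovering H →
                             ∀ i → ∃ (IsPrivatePoint i)
  irredundant⇒privatePoint em ((_ , cover) , irredundant) i =
    dne λ no-private → irredundant i λ x → dne λ x-only-in-i →
      let only-i : ∀ j → H j x → j ≡ i
          only-i j Hjx = dne λ j≢i → x-only-in-i (j , j≢i , Hjx)
          (k , Hkx) = cover x
      in no-private (x , subst (λ m → H m x) (only-i k Hkx) Hkx , only-i)
    where dne = em⇒dne em

  module _ (cover : ∀ x → ∃ λ i → H i x)
           (privatePoint : ∀ i → ∃ (IsPrivatePoint i)) where

    private
      R-refl : Reflexive (induced H)
      R-refl = induced-refl cover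

    ↓-∩ᶜ↑-empty : {P : Pred X 0ℓ} → (P ∩ ((P ᶜ) ↑)) ↓ ⊆ ∅
    ↓-∩ᶜ↑-empty {x = x} h =
      let (k , Hkx) = cover x
          (p , priv@(Hkp , _)) = privatePoint k
          (_ , (t , pRt , ¬Pt)) = h p (k , Hkx , Hkp)
      in ¬Pt (proj₁ (h t (k , Hkx , privatePoint⇒induced⊆block priv pRt)))

    ↓-↑∩↑-empty⇒disjoint : {Y Z : Pred X 0ℓ} → ((Y ↑) ∩ (Z ↑)) ↓ ⊆ ∅ → Z ⊆ (Y ↑) ᶜ
    ↓-↑∩↑-empty⇒disjoint empty Zz (y , (m , Hmz , Hmy) , Yy) =
      let (p , priv) = privatePoint m
      in empty {p} λ t pRt →
           let Hmt = privatePoint⇒induced⊆block priv pRt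
           in meets⇒block⊆↑ Hmy Yy Hmt , meets⇒block⊆↑ Hmz Zz Hmt

    pseudocomplement : {A B : Pred X 0ℓ} → InRS (A , B) →
                       IsPseudocomplement (A , B) (((B ᶜ) ↓) , ((B ᶜ) ↑))
    pseudocomplement {A} {B} AB∈RS@(_ , _ , (B⊆Y↑ , Y↑⊆B)) =
      (B ᶜ , ≐-refl , ≐-refl) , λ where
        (C , D) (Z , (C⊆Z↓ , _) , (D⊆Z↑ , Z↑⊆D)) →
          meet-bot⇒below C⊆Z↓ D⊆Z↑ Z↑⊆D , below⇒meet-bot
      where
      meet-bot⇒below : ∀ {C D Z : Pred X 0ℓ} → C ⊆ Z ↓ → D ⊆ Z ↑ → Z ↑ ⊆ D →
                       ((A , B) ∧ᴿ (C , D)) ≈ᴿ bot → (C , D) ≤ᴿ (((B ᶜ) ↓) , ((B ᶜ) ↑))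
      meet-bot⇒below {Z = Z} C⊆Z↓ D⊆Z↑ Z↑⊆D (_ , (upper-empty , _)) =
        ↓-mono Z⊆Bᶜ ∘ C⊆Z↓ , ↑-mono Z⊆Bᶜ ∘ D⊆Z↑
        where
        Z⊆Bᶜ : Z ⊆ B ᶜ
        Z⊆Bᶜ Zz Bz = ↓-↑∩↑-empty⇒disjoint
          (upper-empty ∘ id⊆↑ R-refl ∘ ↓-mono (map Y↑⊆B Z↑⊆D)) Zz (B⊆Y↑ Bz)

      below⇒meet-bot : ∀ {C D} → (C , D) ≤ᴿ (((B ᶜ) ↓) , ((B ᶜ) ↑)) →
                       ((A , B) ∧ᴿ (C , D)) ≈ᴿ bot
      below⇒meet-bot (C⊆Bᶜ↓ , D⊆Bᶜ↑) =
        ((λ (Ax , Cx) → ↓⊆id R-refl (C⊆Bᶜ↓ Cx) (InRS⇒lower⊆upper R-refl AB∈RS Ax)) , λ ()) ,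
        (↑-empty (↓-∩ᶜ↑-empty ∘ ↓-mono (map₂ D⊆Bᶜ↑)) , λ ())

    module _ (em : ExcludedMiddle 0ℓ) where

      ↑-∪ᶜ↓-full : {P : Pred X 0ℓ} → U ⊆ (P ∪ ((P ᶜ) ↓)) ↑
      ↑-∪ᶜ↓-full {P} {y} _ with cover y
      ... | k , Hky with privatePoint k
      ... | p , priv@(Hkp , _) with em {∃ λ w → induced H p w × P w}
      ... | yes (w , pRw , Pw) = w , (k , Hky , privatePoint⇒induced⊆block priv pRw) , inj₁ Pw
      ... | no ¬P↑p = p , (k , Hky , Hkp) , inj₂ λ w pRw Pw → ¬P↑p (w , pRw , Pw)

      ↑-↓∪↓-full⇒ᶜ⊆ : {Y Z : Pred X 0ℓ} → U ⊆ ((Y ↓) ∪ (Z ↓)) ↑ → (Y ↓) ᶜ ⊆ Z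
      ↑-↓∪↓-full⇒ᶜ⊆ {Y} {Z} full {x} ¬Y↓x =
        em⇒dne em λ ¬Zx → ¬Y↓x λ _ (_ , Hmx , Hmy) → blocks-at-x⊆Y ¬Zx Hmx Hmy
        where
        blocks-at-x⊆Y : ¬ Z x → ∀ {m} → H m x → H m ⊆ Y
        blocks-at-x⊆Y ¬Zx {m} Hmx Hmy with privatePoint m
        ... | p , priv with full {p} tt
        ... | _ , pRt , inj₁ Y↓t = Y↓t _ (_ , privatePoint⇒induced⊆block priv pRt , Hmy)
        ... | _ , pRt , inj₂ Z↓t =
          ⊥-elim (¬Zx (Z↓t x (_ , privatePoint⇒induced⊆block priv pRt , Hmx)))

      dualPseudocomplement : {A B : Pred X 0ℓ} → InRS (A , B) →
                             IsDualPseudocomplement (A , B) (((A ᶜ) ↓) , ((A ᶜ) ↑))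
      dualPseudocomplement {A} {B} AB∈RS@(_ , (A⊆Y↓ , Y↓⊆A) , _) =
        (A ᶜ , ≐-refl , ≐-refl) , λ where
          (C , D) (Z , (C⊆Z↓ , Z↓⊆C) , (_ , Z↑⊆D)) →
            join-top⇒above C⊆Z↓ Z↓⊆C Z↑⊆D , above⇒join-top
        where
        join-top⇒above : ∀ {C D Z : Pred X 0ℓ} → C ⊆ Z ↓ → Z ↓ ⊆ C → Z ↑ ⊆ D →
                         ((A , B) ∨ᴿ (C , D)) ≈ᴿ top → (((A ᶜ) ↓) , ((A ᶜ) ↑)) ≤ᴿ (C , D)
        join-top⇒above {Z = Z} C⊆Z↓ Z↓⊆C Z↑⊆D ((_ , U⊆lower) , _) =
          Z↓⊆C ∘ ↓-mono Aᶜ⊆Z , Z↑⊆D ∘ ↑-mono Aᶜ⊆Z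
          where
          Aᶜ⊆Z : A ᶜ ⊆ Z
          Aᶜ⊆Z ¬Ax = ↑-↓∪↓-full⇒ᶜ⊆
            (λ u → ↑-mono (Sum.map A⊆Y↓ C⊆Z↓) (↓⊆id R-refl (U⊆lower u))) (¬Ax ∘ Y↓⊆A)

        above⇒join-top : ∀ {C D} → (((A ᶜ) ↓) , ((A ᶜ) ↑)) ≤ᴿ (C , D) →
                         ((A , B) ∨ᴿ (C , D)) ≈ᴿ top
        above⇒join-top {D = D} (Aᶜ↓⊆C , Aᶜ↑⊆D) =
          ((λ _ → tt) , ↓-full (↑-mono (Sum.map₂ Aᶜ↓⊆C) ∘ ↑-∪ᶜ↓-full)) ,
          ((λ _ → tt) , B∪D-full)
          where
          B∪D-full : U ⊆ B ∪ D
          B∪D-full {x} _ with em {A x}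
          ... | yes Ax = inj₁ (InRS⇒lower⊆upper R-refl AB∈RS Ax)
          ... | no ¬Ax = inj₂ (Aᶜ↑⊆D (id⊆↑ R-refl ¬Ax))

lemma3p3 : ExcludedMiddle 0ℓ →
    {X I : Set} (H : I → Pred X 0ℓ) → IsIrredundantCovering H →
    let open Approx (induced H) in
    (A B : Pred X 0ℓ) → InRS (A , B) →
    IsPseudocomplement (A , B) (((B ᶜ) ↓) , ((B ᶜ) ↑))
    × IsDualPseudocomplement (A , B) (((A ᶜ) ↓) , ((A ᶜ) ↑))
lemma3p3 em H irr _ _ AB∈RS =
  pseudocomplement H cover privatePoint AB∈RS ,
  dualPseudocomplement H cover privatePoint em AB∈RS
  where
  cover : ∀ x → ∃ λ i → H i x
  cover = proj₂ (proj₁ irr)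
  privatePoint : ∀ i → ∃ (IsPrivatePoint H i)
  privatePoint = irredundant⇒privatePoint H em irr
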